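{- Let $Q\ge2$ be an integer and let $\phi=(aI_r|L)\in M_{r\times g}(\mathbb{Z})$ be Gauss-reduced. Then there exists a Gauss-reduced $\psi=(fI_r|L')\in M_{r\times g}(\mathbb{Z})$ such that (i) $H(\psi)=f\le Q^{rg-r^2+1}$; (ii) $\left|\frac{\psi}{f}-\frac{\phi}{a}\right|\le Q^{ -\frac12}f^{ -1-\frac{1}{2(rg-r^2+1)}}$, where for a real matrix $|\cdot|$ denotes the maximum of the absolute values of its entries.
   Context: $H(\cdot)$ of an integer matrix is the maximum absolute value of its entries. An integer matrix $\phi\in M_{r\times g}(\mathbb{Z})$ of rank $r$ is Gauss-reduced if there is a positive integer $a$ such that $aI_r$ is a submatrix of $\phi$, $H(\phi)=a$, and the greatest common divisor of the entries of $\phi$ is $1$. -}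

module Defs where

open import Data.Nat as ℕ using (ℕ; _≤_; _<_; _⊔_; _^_)
open import Data.Nat.Divisibility using (_∣_)
open import Data.Integer as ℤ using (ℤ; +_; ∣_∣)
open import Data.Fin as Fin using (Fin; inject≤)
open import Data.List using (List; foldr; concatMap; map; allFin)
open import Data.Product using (Σ; ∃; _×_)
open import Relation.Nullary.Decidable using (⌊_⌋)
open import Relation.Binary.PropositionalEquality using (_≡_)
open import Data.Bool using (if_then_else_)

Matrix : ℕ → ℕ → Set
Matrix r g = Fin r → Fin g → ℤ

scalarEntry : {r : ℕ} → ℕ → Fin r → Fin r → ℤ
scalarEntry a i j = if ⌊ i Fin.≟ j ⌋ then + a else + 0

-- H(φ) = maximum absolute value of the entries (0 for an empty matrix)
H : {r g : ℕ} → Matrix r g → ℕ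
H {r} {g} φ = foldr _⊔_ 0 (concatMap (λ i → map (λ j → ∣ φ i j ∣) (allFin g)) (allFin r))

HasScalarSubmatrix : {r g : ℕ} → Matrix r g → ℕ → Set
HasScalarSubmatrix {r} {g} φ a =
  Σ (Fin r → Fin g) λ c →
    (∀ j k → j Fin.< k → c j Fin.< c k) ×
    (∀ i j → φ i (c j) ≡ scalarEntry a i j)

EntriesCoprime : {r g : ℕ} → Matrix r g → Set
EntriesCoprime φ = ∀ (d : ℕ) → (∀ i j → d ∣ ∣ φ i j ∣) → d ≡ 1

GaussReducedWith : {r g : ℕ} → Matrix r g → ℕ → Set
GaussReducedWith φ a =
  (0 < a) × HasScalarSubmatrix φ a × (H φ ≡ a) × EntriesCoprime φ

GaussReduced : {r g : ℕ} → Matrix r g → Set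
GaussReduced φ = ∃ λ a → GaussReducedWith φ a

-- φ has the shape (a I_r | L): its first r columns form a·I_r.
LeftScalarBlock : {r g : ℕ} → r ≤ g → Matrix r g → ℕ → Set
LeftScalarBlock {r} r≤g φ a = ∀ (i j : Fin r) → φ i (inject≤ j r≤g) ≡ scalarEntry a i j

expN : ℕ → ℕ → ℕ
expN r g = r ℕ.* g ℕ.∸ r ℕ.* r ℕ.+ 1

-- Entrywise form of |ψ/f − φ/a| ≤ Q^{-1/2} f^{-1-1/(2N)}, cleared of
-- denominators and raised to the power 2N (all quantities nonnegative):
--   |a ψᵢⱼ − f φᵢⱼ|^{2N} · Q^N · f ≤ a^{2N}  for all i, j.
ApproxBound : {r g : ℕ} → ℕ → ℕ → Matrix r g → ℕ → Matrix r g → ℕ → Set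
ApproxBound N Q ψ f φ a =
  ∀ i j → ∣ (+ a) ℤ.* ψ i j ℤ.- (+ f) ℤ.* φ i j ∣ ^ (2 ℕ.* N) ℕ.* Q ^ N ℕ.* f ≤ a ^ (2 ℕ.* N)

module Submission where

open import Defs
open import Data.Nat using (ℕ; _≤_; _^_)
open import Data.Product using (Σ; _×_)
open import Relation.Binary.PropositionalEquality using (_≡_)

open import Data.Nat as ℕ using (_<_; _⊔_; _∸_; z≤n; NonZero)
import Data.Nat.Properties as ℕP
open import Data.Nat.DivMod using (_/_; _%_; m≡m%n+[m/n]*n; m%n<n; m*n%n≡0; m*n/n≡m; 0/n≡0; m<n*o⇒m/o<n)
import Data.Nat.Divisibility as ℕD
open import Data.Nat.Divisibility using (_∣_)
open import Data.Nat.GCD using (gcd; gcd[m,n]∣m; gcd[m,n]∣n; gcd-greatest)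
open import Data.Nat.Tactic.RingSolver as ℕRing using ()
open import Data.Integer as ℤ using (ℤ; +_; ∣_∣; 0ℤ)
import Data.Integer.Properties as ℤP
import Data.Integer.Divisibility.Signed as ℤD
open import Data.Integer.DivMod using (n%ℕd<d; a≡a%ℕn+[a/ℕn]*n)
open import Data.Integer.Tactic.RingSolver as ℤRing using ()
open import Data.Fin as Fin using (Fin; inject≤; toℕ; fromℕ<)
import Data.Fin.Properties as FinP
open import Data.List using (List; []; _∷_; foldr; concatMap; map; allFin)
open import Data.List.Relation.Unary.All as All using (All; []; _∷_)
open import Data.List.Relation.Unary.Any as Any using (here; there)
open import Data.List.Membership.Propositional using (_∈_)
open import Data.List.Membership.Propositional.Properties
  using (∈-allFin; ∈-map⁺; ∈-map⁻; ∈-concatMap⁺; ∈-concatMap⁻)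
open import Data.Product using (∃; ∃₂; _,_; proj₁; proj₂; uncurry)
open import Data.Sum using (_⊎_; inj₁; inj₂)
open import Data.Empty using (⊥-elim)
open import Relation.Nullary using (Dec; yes; no)
open import Relation.Nullary.Decidable using (⌊_⌋)
open import Data.Bool using (if_then_else_)
open import Relation.Binary.PropositionalEquality
  using (_≢_; refl; sym; trans; cong; cong₂; subst; subst₂; module ≡-Reasoning)

-- Let n = r(g − r) be the number of entries of L.  For t = 0, …, Q^n sort the
-- remainders of t·L modulo a into Q boxes of width a/Q.  By the pigeonhole
-- principle two multipliers t₁ < t₂ fill the same boxes, so f' = t₂ − t₁ ≤ Q^n
-- and p = ⌊t₂ φ / a⌋ − ⌊t₁ φ / a⌋ satisfy Q·|a pᵢⱼ − f' φᵢⱼ| < a for every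
-- entry, and p = (f' I_r | ·) (`blockDirichlet`).  As |φᵢⱼ| ≤ a this forces
-- |pᵢⱼ| ≤ f' (`numeratorBound`).  Dividing p by the gcd G of its entries gives
-- ψ with coprime entries and ψ = (f I_r | ·), f G = f'; hence ψ is
-- Gauss-reduced with H(ψ) = f, and its error Q·|a ψᵢⱼ − f φᵢⱼ| is G times
-- smaller (module `Reduction`).  Finally Q·|a ψᵢⱼ − f φᵢⱼ| ≤ a together with
-- f ≤ Q^N gives the cleared form of (ii) by raising to the power 2N
-- (`powerBound`).

entries : {A : Set} {r g : ℕ} → (Fin r → Fin g → A) → List A
entries {r = r} {g} h = concatMap (λ i → map (h i) (allFin g)) (allFin r)

∈-entries : {A : Set} {r g : ℕ} (h : Fin r → Fin g → A) (i : Fin r) (j : Fin g) →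
            h i j ∈ entries h
∈-entries {g = g} h i j =
  ∈-concatMap⁺ (λ i → map (h i) (allFin g))
    (Any.map (λ { refl → ∈-map⁺ (h i) (∈-allFin j) }) (∈-allFin i))

All-entries : {A : Set} {r g : ℕ} (P : A → Set) (h : Fin r → Fin g → A) →
              (∀ i j → P (h i j)) → All P (entries h)
All-entries {g = g} P h Ph =
  All.tabulate λ x∈ → inRow (Any.satisfied (∈-concatMap⁻ (λ i → map (h i) (allFin g)) {xs = allFin _} x∈))
  where
  inRow : ∀ {x} → ∃ (λ i → x ∈ map (h i) (allFin g)) → P x
  inRow (i , x∈row) with ∈-map⁻ (h i) x∈row
  ... | j , _ , refl = Ph i j

∈⇒≤max : ∀ {x xs} → x ∈ xs → x ≤ foldr _⊔_ 0 xs
∈⇒≤max {x} {y ∷ ys} (here refl) = ℕP.m≤m⊔n x _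
∈⇒≤max {x} {y ∷ ys} (there x∈) = ℕP.≤-trans (∈⇒≤max x∈) (ℕP.m≤n⊔m y _)

max≤ : ∀ {b xs} → All (_≤ b) xs → foldr _⊔_ 0 xs ≤ b
max≤ [] = z≤n
max≤ (x≤b ∷ xs≤b) = ℕP.⊔-lub x≤b (max≤ xs≤b)

entry≤H : {r g : ℕ} (φ : Matrix r g) (i : Fin r) (j : Fin g) → ∣ φ i j ∣ ≤ H φ
entry≤H φ i j = ∈⇒≤max (∈-entries (λ i j → ∣ φ i j ∣) i j)

H≤ : {r g b : ℕ} (φ : Matrix r g) → (∀ i j → ∣ φ i j ∣ ≤ b) → H φ ≤ b
H≤ φ bounded = max≤ (All-entries (_≤ _) (λ i j → ∣ φ i j ∣) bounded)

content : {r g : ℕ} → Matrix r g → ℕ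
content φ = foldr gcd 0 (entries (λ i j → ∣ φ i j ∣))

content∣entry : {r g : ℕ} (φ : Matrix r g) (i : Fin r) (j : Fin g) → content φ ∣ ∣ φ i j ∣
content∣entry φ i j = gcd∣ (∈-entries (λ i j → ∣ φ i j ∣) i j)
  where
  gcd∣ : ∀ {x xs} → x ∈ xs → foldr gcd 0 xs ∣ x
  gcd∣ {x} {y ∷ ys} (here refl) = gcd[m,n]∣m x _
  gcd∣ {x} {y ∷ ys} (there x∈) = ℕD.∣-trans (gcd[m,n]∣n y _) (gcd∣ x∈)

∣content : {r g d : ℕ} (φ : Matrix r g) → (∀ i j → d ∣ ∣ φ i j ∣) → d ∣ content φ
∣content φ divides = ∣gcd (All-entries (_ ∣_) (λ i j → ∣ φ i j ∣) divides)
  where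
  ∣gcd : ∀ {d xs} → All (d ∣_) xs → d ∣ foldr gcd 0 xs
  ∣gcd [] = ℕD._∣0 _
  ∣gcd (d∣x ∷ d∣xs) = gcd-greatest d∣x (∣gcd d∣xs)

module Primitive {r g : ℕ} (p : Matrix r g) (i₀ : Fin r) (j₀ : Fin g) (p₀≢0 : p i₀ j₀ ≢ 0ℤ) where

  -- the content divides the nonzero entry p i₀ j₀, so it is nonzero
  instance
    content-nonZero : NonZero (content p)
    content-nonZero = ℕ.≢-nonZero λ G≡0 →
      p₀≢0 (ℤP.∣i∣≡0⇒i≡0 (ℕD.0∣⇒≡0 (subst (_∣ ∣ p i₀ j₀ ∣) G≡0 (content∣entry p i₀ j₀))))

  divides : ∀ i j → + content p ℤD.∣ p i j
  divides i j = ℤD.∣ᵤ⇒∣ (content∣entry p i j)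

  primitivePart : Matrix r g
  primitivePart i j = ℤD._∣_.quotient (divides i j)

  primitivePart-scales : ∀ i j → p i j ≡ primitivePart i j ℤ.* + content p
  primitivePart-scales i j = ℤD._∣_.equality (divides i j)

  abs-scales : ∀ i j → ∣ p i j ∣ ≡ ∣ primitivePart i j ∣ ℕ.* content p
  abs-scales i j = trans (cong ∣_∣ (primitivePart-scales i j)) (ℤP.abs-* (primitivePart i j) (+ content p))

  -- a common divisor d of the entries of the primitive part gives the common
  -- divisor d·G of the entries of p, which must divide G
  primitivePart-coprime : EntriesCoprime primitivePart
  primitivePart-coprime d d∣entries =
    ℕD.∣1⇒≡1 (ℕD.*-cancelʳ-∣ G (subst (d ℕ.* G ∣_) (sym (ℕP.*-identityˡ G)) (∣content p dG∣p)))
    where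
    G : ℕ
    G = content p
    dG∣p : ∀ i j → d ℕ.* G ∣ ∣ p i j ∣
    dG∣p i j = subst (d ℕ.* G ∣_) (sym (abs-scales i j)) (ℕD.*-monoˡ-∣ G (d∣entries i j))

scalarEntry-cases : {r : ℕ} (i j : Fin r) →
  (∀ c → scalarEntry c i j ≡ + c) ⊎ (∀ c → scalarEntry c i j ≡ + 0)
scalarEntry-cases i j = cases (i Fin.≟ j)
  where
  cases : (d : Dec (i ≡ j)) →
    (∀ c → (if ⌊ d ⌋ then + c else + 0) ≡ + c) ⊎
    (∀ c → (if ⌊ d ⌋ then + c else + 0) ≡ + 0)
  cases (yes _) = inj₁ λ _ → refl
  cases (no _) = inj₂ λ _ → refl

scalarEntry-diag : {r : ℕ} (c : ℕ) (i : Fin r) → scalarEntry c i i ≡ + c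
scalarEntry-diag c i = onDecision (i Fin.≟ i)
  where
  onDecision : (d : Dec (i ≡ i)) → (if ⌊ d ⌋ then + c else + 0) ≡ + c
  onDecision (yes _) = refl
  onDecision (no i≢i) = ⊥-elim (i≢i refl)

scalarEntry-* : {r : ℕ} (m n : ℕ) (i j : Fin r) → scalarEntry (m ℕ.* n) i j ≡ scalarEntry m i j ℤ.* + n
scalarEntry-* m n i j with scalarEntry-cases i j
... | inj₁ diag rewrite diag (m ℕ.* n) | diag m = ℤP.pos-* m n
... | inj₂ off rewrite off (m ℕ.* n) | off m = sym (ℤP.*-zeroˡ (+ n))

+-∸ : ∀ {m n} → m ≤ n → + (n ∸ m) ≡ + n ℤ.- + m
+-∸ {m} {n} m≤n = sym (trans (ℤP.m-n≡m⊖n n m) (ℤP.⊖-≥ m≤n))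

scalarEntry-∸ : {r : ℕ} {m n : ℕ} → m ≤ n → (i j : Fin r) →
                scalarEntry n i j ℤ.- scalarEntry m i j ≡ scalarEntry (n ∸ m) i j
scalarEntry-∸ {m = m} {n} m≤n i j with scalarEntry-cases i j
... | inj₁ diag rewrite diag n | diag m | diag (n ∸ m) = sym (+-∸ m≤n)
... | inj₂ off rewrite off n | off m | off (n ∸ m) = refl

sameQuotient⇒close : ∀ x y a .{{_ : NonZero a}} → x / a ≡ y / a → ℕ.∣ x - y ∣ < a
sameQuotient⇒close x y a eq = begin-strict
    ℕ.∣ x - y ∣
  ≡⟨ cong₂ ℕ.∣_-_∣ (m≡m%n+[m/n]*n x a) (trans (m≡m%n+[m/n]*n y a) (cong (λ q → y % a ℕ.+ q ℕ.* a) (sym eq))) ⟩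
    ℕ.∣ x % a ℕ.+ x / a ℕ.* a - y % a ℕ.+ x / a ℕ.* a ∣
  ≡⟨ cong₂ ℕ.∣_-_∣ (ℕP.+-comm (x % a) _) (ℕP.+-comm (y % a) _) ⟩
    ℕ.∣ x / a ℕ.* a ℕ.+ x % a - x / a ℕ.* a ℕ.+ y % a ∣
  ≡⟨ ℕP.∣m+n-m+o∣≡∣n-o∣ (x / a ℕ.* a) _ _ ⟩
    ℕ.∣ x % a - y % a ∣
  ≤⟨ ℕP.∣m-n∣≤m⊔n (x % a) (y % a) ⟩
    x % a ⊔ y % a
  <⟨ ℕP.⊔-lub (m%n<n x a) (m%n<n y a) ⟩
    a
  ∎
  where open ℕP.≤-Reasoning

∣[+m]-[+n]∣ : ∀ m n → ∣ + m ℤ.- + n ∣ ≡ ℕ.∣ m - n ∣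
∣[+m]-[+n]∣ m n with ℕP.≤-total m n
... | inj₁ m≤n = trans (ℤP.∣i-j∣≡∣j-i∣ (+ m) (+ n))
                   (trans (cong ∣_∣ (sym (+-∸ m≤n))) (sym (ℕP.m≤n⇒∣m-n∣≡n∸m m≤n)))
... | inj₂ n≤m = trans (cong ∣_∣ (sym (+-∸ n≤m))) (sym (ℕP.m≤n⇒∣n-m∣≡n∸m n≤m))

module Division (a : ℕ) .{{_ : NonZero a}} where

  quot : ℕ → ℤ → ℤ
  quot t L = (+ t ℤ.* L) ℤ./ℕ a

  rem : ℕ → ℤ → ℕ
  rem t L = (+ t ℤ.* L) ℤ.%ℕ a

  division : ∀ t L → + t ℤ.* L ≡ + rem t L ℤ.+ quot t L ℤ.* + a
  division t L = a≡a%ℕn+[a/ℕn]*n (+ t ℤ.* L) a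

  quotientError : ∀ {t₁ t₂} → t₁ ≤ t₂ → ∀ L →
    + a ℤ.* (quot t₂ L ℤ.- quot t₁ L) ℤ.- + (t₂ ∸ t₁) ℤ.* L ≡ + rem t₁ L ℤ.- + rem t₂ L
  quotientError {t₁} {t₂} t₁≤t₂ L = begin
      + a ℤ.* (q₂ ℤ.- q₁) ℤ.- + (t₂ ∸ t₁) ℤ.* L
    ≡⟨ cong (λ d → + a ℤ.* (q₂ ℤ.- q₁) ℤ.- d ℤ.* L) (+-∸ t₁≤t₂) ⟩
      + a ℤ.* (q₂ ℤ.- q₁) ℤ.- (+ t₂ ℤ.- + t₁) ℤ.* L
    ≡⟨ expand (+ a) q₁ q₂ (+ t₁) (+ t₂) L ⟩
      + a ℤ.* (q₂ ℤ.- q₁) ℤ.- (+ t₂ ℤ.* L ℤ.- + t₁ ℤ.* L)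
    ≡⟨ cong₂ (λ x y → + a ℤ.* (q₂ ℤ.- q₁) ℤ.- (x ℤ.- y)) (division t₂ L) (division t₁ L) ⟩
      + a ℤ.* (q₂ ℤ.- q₁) ℤ.- ((+ rem t₂ L ℤ.+ q₂ ℤ.* + a) ℤ.- (+ rem t₁ L ℤ.+ q₁ ℤ.* + a))
    ≡⟨ cancel (+ a) q₁ q₂ (+ rem t₁ L) (+ rem t₂ L) ⟩
      + rem t₁ L ℤ.- + rem t₂ L
    ∎
    where
    open ≡-Reasoning
    q₁ q₂ : ℤ
    q₁ = quot t₁ L
    q₂ = quot t₂ L
    expand : ∀ A x y s t M → A ℤ.* (y ℤ.- x) ℤ.- (t ℤ.- s) ℤ.* M ≡ A ℤ.* (y ℤ.- x) ℤ.- (t ℤ.* M ℤ.- s ℤ.* M)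
    expand = ℤRing.solve-∀
    cancel : ∀ A x y u v → A ℤ.* (y ℤ.- x) ℤ.- ((v ℤ.+ y ℤ.* A) ℤ.- (u ℤ.+ x ℤ.* A)) ≡ u ℤ.- v
    cancel = ℤRing.solve-∀

  quot-scalar : ∀ t {r} (i j : Fin r) → quot t (scalarEntry a i j) ≡ scalarEntry t i j
  quot-scalar t i j with scalarEntry-cases i j
  ... | inj₁ diag rewrite diag a | diag t =
    trans (cong (ℤ._/ℕ a) (sym (ℤP.pos-* t a))) (cong +_ (m*n/n≡m t a))
  ... | inj₂ off rewrite off a | off t =
    trans (cong (ℤ._/ℕ a) (ℤP.*-zeroʳ (+ t))) (cong +_ (0/n≡0 a))

  rem-scalar : ∀ t {r} (i j : Fin r) → rem t (scalarEntry a i j) ≡ 0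
  rem-scalar t i j with scalarEntry-cases i j
  ... | inj₁ diag rewrite diag a = trans (cong (ℤ._%ℕ a) (sym (ℤP.pos-* t a))) (m*n%n≡0 t a)
  ... | inj₂ off rewrite off a = trans (cong (ℤ._%ℕ a) (ℤP.*-zeroʳ (+ t))) (m*n%n≡0 0 a)

  -- the box of width a/Q containing the remainder of t·L
  box : (Q t : ℕ) → ℤ → ℕ
  box Q t L = Q ℕ.* rem t L / a

  box<Q : ∀ Q .{{_ : NonZero Q}} t L → box Q t L < Q
  box<Q Q t L = m<n*o⇒m/o<n (ℕP.*-monoʳ-< Q (n%ℕd<d (+ t ℤ.* L) a))

  boxes : (Q : ℕ) .{{_ : NonZero Q}} {n : ℕ} → (Fin n → ℤ) → ℕ → Fin n → Fin Q
  boxes Q L t x = fromℕ< (box<Q Q t (L x))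

  sameBox⇒close : ∀ Q {t₁ t₂} L → box Q t₁ L ≡ box Q t₂ L →
                  Q ℕ.* ∣ + rem t₁ L ℤ.- + rem t₂ L ∣ < a
  sameBox⇒close Q {t₁} {t₂} L same = begin-strict
      Q ℕ.* ∣ + rem t₁ L ℤ.- + rem t₂ L ∣
    ≡⟨ cong (Q ℕ.*_) (∣[+m]-[+n]∣ (rem t₁ L) (rem t₂ L)) ⟩
      Q ℕ.* ℕ.∣ rem t₁ L - rem t₂ L ∣
    ≡⟨ ℕP.*-distribˡ-∣-∣ Q (rem t₁ L) (rem t₂ L) ⟩
      ℕ.∣ Q ℕ.* rem t₁ L - Q ℕ.* rem t₂ L ∣
    <⟨ sameQuotient⇒close (Q ℕ.* rem t₁ L) (Q ℕ.* rem t₂ L) a same ⟩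
      a
    ∎
    where open ℕP.≤-Reasoning

  CloseMultipliers : (Q : ℕ) {n : ℕ} → (Fin n → ℤ) → ℕ → Set
  CloseMultipliers Q L B =
    ∃₂ λ t₁ t₂ → t₁ < t₂ × t₂ ≤ B × (∀ x → Q ℕ.* ∣ + rem t₁ (L x) ℤ.- + rem t₂ (L x) ∣ < a)

  dirichlet : (Q : ℕ) .{{_ : NonZero Q}} (n : ℕ) (L : Fin n → ℤ) → CloseMultipliers Q L (Q ^ n)
  dirichlet Q n L with FinP.pigeonhole (ℕP.n<1+n (Q ^ n)) (λ s → Fin.funToFin (boxes Q L (toℕ s)))
  ... | s₁ , s₂ , s₁<s₂ , sameCode =
    toℕ s₁ , toℕ s₂ , s₁<s₂ , ℕ.s≤s⁻¹ (FinP.toℕ<n s₂) , λ x → sameBox⇒close Q {toℕ s₁} {toℕ s₂} (L x) (sameBox x)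
    where
    sameBox : ∀ x → box Q (toℕ s₁) (L x) ≡ box Q (toℕ s₂) (L x)
    sameBox x = begin
        box Q (toℕ s₁) (L x)
      ≡⟨ FinP.toℕ-fromℕ< (box<Q Q (toℕ s₁) (L x)) ⟨
        toℕ (boxes Q L (toℕ s₁) x)
      ≡⟨ cong toℕ (FinP.finToFun-funToFin (boxes Q L (toℕ s₁)) x) ⟨
        toℕ (Fin.finToFun (Fin.funToFin (boxes Q L (toℕ s₁))) x)
      ≡⟨ cong (λ c → toℕ (Fin.finToFun c x)) sameCode ⟩
        toℕ (Fin.finToFun (Fin.funToFin (boxes Q L (toℕ s₂))) x)
      ≡⟨ cong toℕ (FinP.finToFun-funToFin (boxes Q L (toℕ s₂)) x) ⟩
        toℕ (boxes Q L (toℕ s₂) x)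
      ≡⟨ FinP.toℕ-fromℕ< (box<Q Q (toℕ s₂) (L x)) ⟩
        box Q (toℕ s₂) (L x)
      ∎
      where open ≡-Reasoning

offBlockColumn : {r g : ℕ} → r ≤ g → Fin (g ∸ r) → Fin g
offBlockColumn {r} r≤g k = Fin.cast (ℕP.m+[n∸m]≡n r≤g) (r Fin.↑ʳ k)

columnCases : {r g : ℕ} (r≤g : r ≤ g) (j : Fin g) →
  (∃ λ j₀ → j ≡ inject≤ j₀ r≤g) ⊎ (∃ λ k → j ≡ offBlockColumn r≤g k)
columnCases {r} r≤g j with toℕ j ℕ.<? r
... | yes j<r = inj₁ (fromℕ< j<r ,
  FinP.toℕ-injective (sym (trans (FinP.toℕ-inject≤ (fromℕ< j<r) r≤g) (FinP.toℕ-fromℕ< j<r))))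
... | no j≮r = inj₂ (fromℕ< k<g-r , FinP.toℕ-injective (sym (begin
    toℕ (offBlockColumn r≤g (fromℕ< k<g-r))
  ≡⟨ FinP.toℕ-cast _ (r Fin.↑ʳ fromℕ< k<g-r) ⟩
    toℕ (r Fin.↑ʳ fromℕ< k<g-r)
  ≡⟨ FinP.toℕ-↑ʳ r (fromℕ< k<g-r) ⟩
    r ℕ.+ toℕ (fromℕ< k<g-r)
  ≡⟨ cong (r ℕ.+_) (FinP.toℕ-fromℕ< k<g-r) ⟩
    r ℕ.+ (toℕ j ∸ r)
  ≡⟨ ℕP.m+[n∸m]≡n r≤j ⟩
    toℕ j
  ∎)))
  where
  open ≡-Reasoning
  r≤j : r ≤ toℕ j
  r≤j = ℕP.≮⇒≥ j≮r
  k<g-r : toℕ j ∸ r < _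
  k<g-r = ℕP.∸-monoˡ-< (FinP.toℕ<n j) r≤j

offBlockEntries : {r g : ℕ} → r ≤ g → Matrix r g → Fin (r ℕ.* (g ∸ r)) → ℤ
offBlockEntries {r} {g} r≤g φ x = uncurry (λ i k → φ i (offBlockColumn r≤g k)) (Fin.remQuot (g ∸ r) x)

offBlockEntries-combine : {r g : ℕ} (r≤g : r ≤ g) (φ : Matrix r g) (i : Fin r) (k : Fin (g ∸ r)) →
  offBlockEntries r≤g φ (Fin.combine i k) ≡ φ i (offBlockColumn r≤g k)
offBlockEntries-combine r≤g φ i k =
  cong (uncurry (λ i k → φ i (offBlockColumn r≤g k))) (FinP.remQuot-combine i k)

BlockApproximation : (Q : ℕ) {r g : ℕ} → r ≤ g → Matrix r g → ℕ → Set
BlockApproximation Q {r} {g} r≤g φ a =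
  Σ ℕ λ f' → Σ (Matrix r g) λ p →
    0 < f' × f' ≤ Q ^ (r ℕ.* (g ∸ r)) × LeftScalarBlock r≤g p f' ×
    (∀ i j → Q ℕ.* ∣ + a ℤ.* p i j ℤ.- + f' ℤ.* φ i j ∣ < a)

blockDirichlet : (Q : ℕ) .{{_ : NonZero Q}} {r g : ℕ} (r≤g : r ≤ g) (φ : Matrix r g)
  (a : ℕ) .{{_ : NonZero a}} → LeftScalarBlock r≤g φ a → BlockApproximation Q r≤g φ a
blockDirichlet Q {r} {g} r≤g φ a φBlock = fromMultipliers (dirichlet Q (r ℕ.* (g ∸ r)) (offBlockEntries r≤g φ))
  where
  open Division a

  -- with p = quot t₂ φ − quot t₁ φ the error a p − (t₂ − t₁) φ is the
  -- difference of the remainders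
  fromMultipliers : CloseMultipliers Q (offBlockEntries r≤g φ) (Q ^ (r ℕ.* (g ∸ r))) →
                    BlockApproximation Q r≤g φ a
  fromMultipliers (t₁ , t₂ , t₁<t₂ , t₂≤Qⁿ , offBlockClose) =
    t₂ ∸ t₁ , p , ℕP.m<n⇒0<n∸m t₁<t₂ , ℕP.≤-trans (ℕP.m∸n≤m t₂ t₁) t₂≤Qⁿ , pBlock , error
    where
    t₁≤t₂ : t₁ ≤ t₂
    t₁≤t₂ = ℕP.<⇒≤ t₁<t₂

    p : Matrix r g
    p i j = quot t₂ (φ i j) ℤ.- quot t₁ (φ i j)

    pBlock : LeftScalarBlock r≤g p (t₂ ∸ t₁)
    pBlock i j₀ = begin
        quot t₂ (φ i (inject≤ j₀ r≤g)) ℤ.- quot t₁ (φ i (inject≤ j₀ r≤g))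
      ≡⟨ cong (λ L → quot t₂ L ℤ.- quot t₁ L) (φBlock i j₀) ⟩
        quot t₂ (scalarEntry a i j₀) ℤ.- quot t₁ (scalarEntry a i j₀)
      ≡⟨ cong₂ ℤ._-_ (quot-scalar t₂ i j₀) (quot-scalar t₁ i j₀) ⟩
        scalarEntry t₂ i j₀ ℤ.- scalarEntry t₁ i j₀
      ≡⟨ scalarEntry-∸ t₁≤t₂ i j₀ ⟩
        scalarEntry (t₂ ∸ t₁) i j₀
      ∎
      where open ≡-Reasoning

    -- block entries have remainder 0; the others are covered by Dirichlet
    remaindersClose : ∀ i j → Q ℕ.* ∣ + rem t₁ (φ i j) ℤ.- + rem t₂ (φ i j) ∣ < a
    remaindersClose i j with columnCases r≤g j
    ... | inj₁ (j₀ , refl) rewrite φBlock i j₀ | rem-scalar t₁ i j₀ | rem-scalar t₂ i j₀ =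
      subst (_< a) (sym (ℕP.*-zeroʳ Q)) (ℕ.>-nonZero⁻¹ a)
    ... | inj₂ (k , refl) =
      subst (λ L → Q ℕ.* ∣ + rem t₁ L ℤ.- + rem t₂ L ∣ < a)
        (offBlockEntries-combine r≤g φ i k) (offBlockClose (Fin.combine i k))

    error : ∀ i j → Q ℕ.* ∣ + a ℤ.* p i j ℤ.- + (t₂ ∸ t₁) ℤ.* φ i j ∣ < a
    error i j = subst (λ e → Q ℕ.* ∣ e ∣ < a) (sym (quotientError t₁≤t₂ (φ i j))) (remaindersClose i j)

numeratorBound : ∀ a f (p L : ℤ) → ∣ + a ℤ.* p ℤ.- + f ℤ.* L ∣ < a → ∣ L ∣ ≤ a → ∣ p ∣ ≤ f
numeratorBound a f p L close L≤a = ℕ.s≤s⁻¹ (ℕP.*-cancelˡ-< a ∣ p ∣ (ℕ.suc f) (begin-strict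
    a ℕ.* ∣ p ∣
  ≡⟨ ℤP.abs-* (+ a) p ⟨
    ∣ + a ℤ.* p ∣
  ≡⟨ cong ∣_∣ (split (+ a ℤ.* p) (+ f ℤ.* L)) ⟩
    ∣ (+ a ℤ.* p ℤ.- + f ℤ.* L) ℤ.+ + f ℤ.* L ∣
  ≤⟨ ℤP.∣i+j∣≤∣i∣+∣j∣ (+ a ℤ.* p ℤ.- + f ℤ.* L) (+ f ℤ.* L) ⟩
    ∣ + a ℤ.* p ℤ.- + f ℤ.* L ∣ ℕ.+ ∣ + f ℤ.* L ∣
  ≡⟨ cong (∣ + a ℤ.* p ℤ.- + f ℤ.* L ∣ ℕ.+_) (ℤP.abs-* (+ f) L) ⟩
    ∣ + a ℤ.* p ℤ.- + f ℤ.* L ∣ ℕ.+ f ℕ.* ∣ L ∣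
  <⟨ ℕP.+-mono-<-≤ close (ℕP.*-monoʳ-≤ f L≤a) ⟩
    a ℕ.+ f ℕ.* a
  ≡⟨ ℕP.*-comm (ℕ.suc f) a ⟩
    a ℕ.* ℕ.suc f
  ∎))
  where
  open ℕP.≤-Reasoning
  split : ∀ x y → x ≡ (x ℤ.- y) ℤ.+ y
  split = ℤRing.solve-∀

blockGaussReduced : {r g : ℕ} (r≤g : r ≤ g) (i₀ : Fin r) (ψ : Matrix r g) (f : ℕ) →
  0 < f → LeftScalarBlock r≤g ψ f → (∀ i j → ∣ ψ i j ∣ ≤ f) → EntriesCoprime ψ →
  GaussReducedWith ψ f
blockGaussReduced r≤g i₀ ψ f f>0 ψBlock bounded coprime = f>0 , submatrix , height , coprime
  where
  submatrix : HasScalarSubmatrix ψ f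
  submatrix = (λ j → inject≤ j r≤g)
            , (λ j k j<k → subst₂ _<_ (sym (FinP.toℕ-inject≤ j r≤g)) (sym (FinP.toℕ-inject≤ k r≤g)) j<k)
            , ψBlock
  -- the diagonal entry ψ i₀ i₀ = f attains the bound
  height : H ψ ≡ f
  height = ℕP.≤-antisym (H≤ ψ bounded)
    (subst (_≤ H ψ) (cong ∣_∣ (trans (ψBlock i₀ i₀) (scalarEntry-diag f i₀))) (entry≤H ψ i₀ (inject≤ i₀ r≤g)))

module Reduction {r g : ℕ} (r≤g : r ≤ g) (i₀ : Fin r) (p : Matrix r g) (f' : ℕ)
                 (f'>0 : 0 < f') (pBlock : LeftScalarBlock r≤g p f') where

  c₀ : Fin g
  c₀ = inject≤ i₀ r≤g

  p₀ : p i₀ c₀ ≡ + f'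
  p₀ = trans (pBlock i₀ i₀) (scalarEntry-diag f' i₀)

  p₀≢0 : p i₀ c₀ ≢ 0ℤ
  p₀≢0 p₀≡0 = ℕP.<⇒≢ f'>0 (sym (cong ∣_∣ (trans (sym p₀) p₀≡0)))

  open Primitive p i₀ c₀ p₀≢0 public

  G : ℕ
  G = content p

  ψ : Matrix r g
  ψ = primitivePart

  f : ℕ
  f = ∣ ψ i₀ c₀ ∣

  f'≡fG : f' ≡ f ℕ.* G
  f'≡fG = trans (cong ∣_∣ (sym p₀)) (abs-scales i₀ c₀)

  f>0 : 0 < f
  f>0 = ℕP.n≢0⇒n>0 λ f≡0 → ℕP.<⇒≢ f'>0 (sym (trans f'≡fG (cong (ℕ._* G) f≡0)))

  ψBlock : LeftScalarBlock r≤g ψ f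
  ψBlock i j₀ = ℤP.*-cancelʳ-≡ (ψ i c) (scalarEntry f i j₀) (+ G) (begin
      ψ i c ℤ.* + G
    ≡⟨ primitivePart-scales i c ⟨
      p i c
    ≡⟨ pBlock i j₀ ⟩
      scalarEntry f' i j₀
    ≡⟨ cong (λ m → scalarEntry m i j₀) f'≡fG ⟩
      scalarEntry (f ℕ.* G) i j₀
    ≡⟨ scalarEntry-* f G i j₀ ⟩
      scalarEntry f i j₀ ℤ.* + G
    ∎)
    where
    open ≡-Reasoning
    c : Fin g
    c = inject≤ j₀ r≤g

  ψBounded : (∀ i j → ∣ p i j ∣ ≤ f') → ∀ i j → ∣ ψ i j ∣ ≤ f
  ψBounded pBounded i j = ℕP.*-cancelʳ-≤ ∣ ψ i j ∣ f G (subst₂ _≤_ (abs-scales i j) f'≡fG (pBounded i j))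

  -- the approximation error of ψ/f is that of p/f' divided by G
  errorShrinks : (φ : Matrix r g) (a : ℕ) (i : Fin r) (j : Fin g) →
    ∣ + a ℤ.* ψ i j ℤ.- + f ℤ.* φ i j ∣ ≤ ∣ + a ℤ.* p i j ℤ.- + f' ℤ.* φ i j ∣
  errorShrinks φ a i j = begin
      ∣ E ∣
    ≤⟨ ℕP.m≤m*n ∣ E ∣ G ⟩
      ∣ E ∣ ℕ.* G
    ≡⟨ ℤP.abs-* E (+ G) ⟨
      ∣ E ℤ.* + G ∣
    ≡⟨ cong ∣_∣ (distribute (+ a) (ψ i j) (+ f) (φ i j) (+ G)) ⟩
      ∣ + a ℤ.* (ψ i j ℤ.* + G) ℤ.- (+ f ℤ.* + G) ℤ.* φ i j ∣
    ≡⟨ cong₂ (λ x y → ∣ + a ℤ.* x ℤ.- y ℤ.* φ i j ∣)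
         (sym (primitivePart-scales i j)) (trans (sym (ℤP.pos-* f G)) (cong +_ (sym f'≡fG))) ⟩
      ∣ + a ℤ.* p i j ℤ.- + f' ℤ.* φ i j ∣
    ∎
    where
    open ℕP.≤-Reasoning
    E : ℤ
    E = + a ℤ.* ψ i j ℤ.- + f ℤ.* φ i j
    distribute : ∀ A s F L H → (A ℤ.* s ℤ.- F ℤ.* L) ℤ.* H ≡ A ℤ.* (s ℤ.* H) ℤ.- (F ℤ.* H) ℤ.* L
    distribute = ℤRing.solve-∀

*-^ : ∀ m n k → (m ℕ.* n) ^ k ≡ m ^ k ℕ.* n ^ k
*-^ m n ℕ.zero = refl
*-^ m n (ℕ.suc k) = trans (cong (m ℕ.* n ℕ.*_) (*-^ m n k)) (interchange m n (m ^ k) (n ^ k))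
  where
  interchange : ∀ w x y z → w ℕ.* x ℕ.* (y ℕ.* z) ≡ w ℕ.* y ℕ.* (x ℕ.* z)
  interchange = ℕRing.solve-∀

-- Q·X ≤ a and f ≤ Q^N give X^{2N} Q^N f ≤ X^{2N} Q^{2N} ≤ a^{2N}
powerBound : ∀ N Q X f a → Q ℕ.* X ≤ a → f ≤ Q ^ N → X ^ (2 ℕ.* N) ℕ.* Q ^ N ℕ.* f ≤ a ^ (2 ℕ.* N)
powerBound N Q X f a QX≤a f≤Q^N = begin
    X ^ (2 ℕ.* N) ℕ.* Q ^ N ℕ.* f
  ≡⟨ ℕP.*-assoc (X ^ (2 ℕ.* N)) (Q ^ N) f ⟩
    X ^ (2 ℕ.* N) ℕ.* (Q ^ N ℕ.* f)
  ≤⟨ ℕP.*-monoʳ-≤ (X ^ (2 ℕ.* N)) (ℕP.*-monoʳ-≤ (Q ^ N) f≤Q^N) ⟩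
    X ^ (2 ℕ.* N) ℕ.* (Q ^ N ℕ.* Q ^ N)
  ≡⟨ cong (X ^ (2 ℕ.* N) ℕ.*_) (trans (sym (ℕP.^-distribˡ-+-* Q N N)) (cong (λ k → Q ^ (N ℕ.+ k)) (sym (ℕP.+-identityʳ N)))) ⟩
    X ^ (2 ℕ.* N) ℕ.* Q ^ (2 ℕ.* N)
  ≡⟨ *-^ X Q (2 ℕ.* N) ⟨
    (X ℕ.* Q) ^ (2 ℕ.* N)
  ≤⟨ ℕP.^-monoˡ-≤ (2 ℕ.* N) (subst (_≤ a) (ℕP.*-comm Q X) QX≤a) ⟩
    a ^ (2 ℕ.* N)
  ∎
  where open ℕP.≤-Reasoning

offBlockSize≤expN : ∀ r g → r ℕ.* (g ∸ r) ≤ expN r g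
offBlockSize≤expN r g = subst (_≤ expN r g) (sym (ℕP.*-distribˡ-∸ r g r)) (ℕP.m≤m+n (r ℕ.* g ∸ r ℕ.* r) 1)

ReducedApproximation : (Q : ℕ) {r g : ℕ} → r ≤ g → Matrix r g → ℕ → Set
ReducedApproximation Q {r} {g} r≤g φ a =
  Σ (Matrix r g) λ ψ → Σ ℕ λ f →
    GaussReducedWith ψ f × LeftScalarBlock r≤g ψ f ×
    (H ψ ≡ f) × (f ≤ Q ^ expN r g) × ApproxBound (expN r g) Q ψ f φ a

-- the lemma for r > 0 (witnessed by a row i₀) and Q, a ≠ 0: reduce the block
-- Dirichlet approximation of φ by its content
approximate : (Q : ℕ) .{{_ : NonZero Q}} {r g : ℕ} (r≤g : r ≤ g) (i₀ : Fin r)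
  (φ : Matrix r g) (a : ℕ) .{{_ : NonZero a}} → H φ ≡ a → LeftScalarBlock r≤g φ a →
  ReducedApproximation Q r≤g φ a
approximate Q {r} {g} r≤g i₀ φ a Hφ φBlock = reduce (blockDirichlet Q r≤g φ a φBlock)
  where
  reduce : BlockApproximation Q r≤g φ a → ReducedApproximation Q r≤g φ a
  reduce (f' , p , f'>0 , f'≤Qⁿ , pBlock , pClose) =
    ψ , f , reduced , ψBlock , proj₁ (proj₂ (proj₂ reduced)) , f≤Q^N , approx
    where
    open Reduction r≤g i₀ p f' f'>0 pBlock
    pBounded : ∀ i j → ∣ p i j ∣ ≤ f'
    pBounded i j = numeratorBound a f' (p i j) (φ i j)
      (ℕP.≤-<-trans (ℕP.m≤n*m _ Q) (pClose i j)) (subst (∣ φ i j ∣ ≤_) Hφ (entry≤H φ i j))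
    reduced : GaussReducedWith ψ f
    reduced = blockGaussReduced r≤g i₀ ψ f f>0 ψBlock (ψBounded pBounded) primitivePart-coprime
    f≤Q^N : f ≤ Q ^ expN r g
    f≤Q^N = ℕP.≤-trans (ℕP.m≤m*n f G)
      (subst (_≤ Q ^ expN r g) f'≡fG (ℕP.≤-trans f'≤Qⁿ (ℕP.^-monoʳ-≤ Q (offBlockSize≤expN r g))))
    approx : ApproxBound (expN r g) Q ψ f φ a
    approx i j = powerBound (expN r g) Q _ f a
      (ℕP.<⇒≤ (ℕP.≤-<-trans (ℕP.*-monoʳ-≤ Q (errorShrinks φ a i j)) (pClose i j))) f≤Q^N

-- For r = 0 the height of φ is 0, contradicting a > 0.
lemma12p1 : (Q : ℕ) → 2 ≤ Q → (r g : ℕ) → (r≤g : r ≤ g) →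
    (φ : Matrix r g) (a : ℕ) → GaussReducedWith φ a → LeftScalarBlock r≤g φ a →
    Σ (Matrix r g) λ ψ → Σ ℕ λ f →
      GaussReducedWith ψ f × LeftScalarBlock r≤g ψ f ×
      (H ψ ≡ f) × (f ≤ Q ^ expN r g) × ApproxBound (expN r g) Q ψ f φ a
lemma12p1 Q Q≥2 ℕ.zero g r≤g φ a (a>0 , _ , Hφ , _) φBlock = ⊥-elim (ℕP.<⇒≢ a>0 Hφ)
lemma12p1 Q Q≥2 (ℕ.suc r) g r≤g φ a (a>0 , _ , Hφ , _) φBlock =
  approximate Q {{ℕ.>-nonZero (ℕP.≤-trans (ℕ.s≤s z≤n) Q≥2)}} r≤g Fin.zero φ a {{ℕ.>-nonZero a>0}} Hφ φBlock
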